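{- Let $\ell,n$ be positive integers with $\ell\leq n$. Then: (i) for every $n\geq 1$, every $n$-permutation is $1$-equalizing; (ii) for every $n\geq 2$, the only $2$-differentiating $n$-permutation is $\delta_n$; (iii) for $3\leq\ell\leq n-1$, the following $n$-permutations are $\ell$-differentiating: $\delta_m\oplus\delta_{n-m}$ for $0\leq m\leq n-1$; and $\pi\ominus\delta_{n-\ell}\ominus\tau$ for every $\pi\in S_p$, $\tau\in S_q$ with $p,q\geq 1$ and $p+q = \ell$; (iv) the only $n$-equalizing $n$-permutation is $\iota_n$.
   Context: Permutations $\sigma\in S_n$ are written as words $\sigma(1)\cdots\sigma(n)$. For $S\subseteq\{1,\dots,n\}$, $|S|=\ell$, $h_S\colon\{1,\dots,\ell\}\to S$ is the order-isomorphism, $\sigma_S := h_{\sigma(S)}^{ -1}\circ\sigma|_S\circ h_S\in S_\ell$, and $\mathrm{Pat}^{(\ell)}\sigma := \{\sigma_S : |S| = \ell\}$. For nonempty $X\subseteq S_\ell$, $\Delta X := \{x^{ -1}\circ y : x,y\in X\}$, and $\langle X\rangle$ is the generated subgroup. $\sigma\in S_n$ is $\ell$-equalizing if $\langle\Delta\,\mathrm{Pat}^{(\ell)}\sigma\rangle\cap\mathrm{Pat}^{(\ell)}\sigma\neq\emptyset$, and $\ell$-differentiating otherwise. $\iota_m = 12\cdots m$ and $\delta_m = m(m-1)\cdots 1$. For $\pi\in S_n$, $\tau\in S_m$, the direct sum $\pi\oplus\tau\in S_{n+m}$ is $(\pi\oplus\tau)(i) = \pi(i)$ for $i\leq n$ and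 $n+\tau(i-n)$ for $i>n$; the skew sum $\pi\ominus\tau\in S_{n+m}$ is $(\pi\ominus\tau)(i) = m+\pi(i)$ for $i\leq n$ and $\tau(i-n)$ for $i>n$. By convention $\delta_0\oplus\delta_m = \delta_m\oplus\delta_0 = \delta_m$ and $\iota_0\ominus\iota_m = \iota_m\ominus\iota_0 = \iota_m$. -}

module Defs where

open import Data.Nat as ℕ using (ℕ; zero; suc)
open import Data.Nat.Properties using (+-comm)
open import Data.Fin as Fin using (Fin; _↑ˡ_; _↑ʳ_; opposite; cast)
open import Data.Vec using (Vec; lookup; tabulate; map; _++_; allFin)
open import Data.Product using (Σ; ∃; _×_)
open import Relation.Binary.PropositionalEquality using (_≡_)
open import Relation.Nullary using (¬_)

-- A word of length n over {1..n} (0-indexed as Fin n): σ(1)⋯σ(n).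
Word : ℕ → Set
Word n = Vec (Fin n) n

IsPerm : ∀ {n} → Word n → Set
IsPerm {n} σ = ∀ (i j : Fin n) → lookup σ i ≡ lookup σ j → i ≡ j

_∘w_ : ∀ {n} → Word n → Word n → Word n
x ∘w y = tabulate (λ i → lookup x (lookup y i))

ι : (n : ℕ) → Word n
ι n = allFin n

δ : (n : ℕ) → Word n
δ n = tabulate opposite

IsInverse : ∀ {n} → Word n → Word n → Set
IsInverse {n} x x' = (x ∘w x' ≡ ι n) × (x' ∘w x ≡ ι n)

_⊕_ : ∀ {n m} → Word n → Word m → Word (n ℕ.+ m)
_⊕_ {n} {m} π τ = map (_↑ˡ m) π ++ map (n ↑ʳ_) τ

-- skew sum π ⊖ τ : π(i) ↦ m + π(i), τ(j) ↦ τ(j)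
_⊖_ : ∀ {n m} → Word n → Word m → Word (n ℕ.+ m)
_⊖_ {n} {m} π τ =
  map (λ i → cast (+-comm m n) (m ↑ʳ i)) π ++ map (λ j → cast (+-comm m n) (j ↑ˡ n)) τ

-- a vector of positions listed in strictly increasing order
-- (i.e. the order-isomorphism h_S : {1..ℓ} → S, for S its image)
StrictlyIncreasing : ∀ {ℓ n} → Vec (Fin n) ℓ → Set
StrictlyIncreasing {ℓ} h = ∀ (i j : Fin ℓ) → i Fin.< j → lookup h i Fin.< lookup h j

-- x = σ_S for some S with |S| = ℓ, where h = h_S and t = h_{σ(S)}:
-- t ∘ x = σ ∘ h, i.e. x = h_{σ(S)}⁻¹ ∘ σ|_S ∘ h_S.
Pat : (ℓ : ℕ) → ∀ {n} → Word n → Word ℓ → Set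
Pat ℓ {n} σ x =
  Σ (Vec (Fin n) ℓ) λ h → Σ (Vec (Fin n) ℓ) λ t →
    StrictlyIncreasing h × StrictlyIncreasing t
    × (∀ (k : Fin ℓ) → ∃ λ (i : Fin ℓ) → lookup t k ≡ lookup σ (lookup h i))
    × (∀ (i : Fin ℓ) → lookup t (lookup x i) ≡ lookup σ (lookup h i))

Δ : ∀ {ℓ} → (Word ℓ → Set) → Word ℓ → Set
Δ X z = ∃ λ x → ∃ λ y → ∃ λ x' → X x × X y × IsInverse x x' × (z ≡ x' ∘w y)

data ⟨_⟩ {ℓ : ℕ} (X : Word ℓ → Set) : Word ℓ → Set where
  gen : ∀ {x} → X x → ⟨ X ⟩ x
  one : ⟨ X ⟩ (ι ℓ)
  mul : ∀ {x y} → ⟨ X ⟩ x → ⟨ X ⟩ y → ⟨ X ⟩ (x ∘w y)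
  inv : ∀ {x x'} → ⟨ X ⟩ x → IsInverse x x' → ⟨ X ⟩ x'

Equalizing : (ℓ : ℕ) → ∀ {n} → Word n → Set
Equalizing ℓ σ = ∃ λ x → Pat ℓ σ x × ⟨ Δ (Pat ℓ σ) ⟩ x

Differentiating : (ℓ : ℕ) → ∀ {n} → Word n → Set
Differentiating ℓ σ = ¬ Equalizing ℓ σ

-- The subgroup ⟨ΔX⟩ lies in every subgroup G of S_ℓ containing ΔX, so σ is ℓ-differentiating as
-- soon as some such G contains no ℓ-pattern of σ.
-- If σ has a single ℓ-pattern w (σ = δ_n and ℓ = 2, or ℓ = n), then ΔX = {ι} and G = {ι} works
-- unless w = ι. Every ℓ-pattern of π ⊖ δ_r ⊖ τ maps the first p positions onto the top p values, so
-- ΔX stabilises {1, …, p}, which no pattern does. Every ℓ-pattern of δ_m ⊕ δ_k reverses the cyclic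
-- order of {1, …, ℓ}, i.e. acts as a reflection of the ℓ-gon, so ΔX lies in the centraliser of the
-- rotation i ↦ i + 1; a pattern in it would make two neighbours each other's successor, which is
-- impossible for ℓ ≥ 3. Conversely ι lies in every generated subgroup, ι_1 is a pattern of every σ,
-- ι_2 of every σ with an ascent, and a permutation without ascents is δ_n.

module Submission where

open import Defs
open import Data.Nat using (ℕ; zero; suc; _+_; _∸_; _≤_; _<_; z≤n; s≤s; z<s; s≤s⁻¹; _<?_)
open import Data.Nat.Properties
open import Data.Fin as Fin using (Fin; toℕ; fromℕ<; opposite; cast; reduce≥; _↑ˡ_; _↑ʳ_)
open import Data.Fin.Properties
  using ( toℕ-injective; toℕ-fromℕ<; toℕ-↑ˡ; toℕ-↑ʳ; toℕ-cast; toℕ<n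
        ; opposite-prop; opposite-involutive; injective⇒≤)
open import Data.Vec using (Vec; []; _∷_; lookup; tabulate; map; _++_; allFin)
open import Data.Vec.Properties
  using (lookup-map; lookup∘tabulate; lookup-allFin; lookup-++-<; lookup-++-≥; tabulate∘lookup; tabulate-cong)
open import Data.Product using (∃; _×_; _,_; proj₁; proj₂)
open import Data.Sum using (inj₁; inj₂)
open import Data.Empty using (⊥-elim)
open import Function.Bundles using (_⇔_; mk⇔; Equivalence)
import Function.Properties.Equivalence as ⇔
open import Relation.Nullary using (¬_; Dec; yes; no)
open import Relation.Binary.PropositionalEquality
  using (_≡_; refl; sym; trans; cong; subst; subst₂; module ≡-Reasoning)
open import Relation.Binary.Definitions using (tri<; tri≈; tri>)

-- Words and subgroups of S_ℓ

lookup-∘w : ∀ {n} (x y : Word n) i → lookup (x ∘w y) i ≡ lookup x (lookup y i)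
lookup-∘w x y = lookup∘tabulate _

≡-fromLookup : ∀ {A : Set} {n} {u v : Vec A n} → (∀ i → lookup u i ≡ lookup v i) → u ≡ v
≡-fromLookup {u = u} {v} eq = trans (sym (tabulate∘lookup u)) (trans (tabulate-cong eq) (tabulate∘lookup v))

∘w-identityˡ : ∀ {n} (x : Word n) → ι n ∘w x ≡ x
∘w-identityˡ x = ≡-fromLookup λ i → trans (lookup-∘w (ι _) x i) (lookup-allFin _)

module _ {n} (x x' : Word n) (inverse : IsInverse x x') where

  inverse-cancelˡ : ∀ i → lookup x (lookup x' i) ≡ i
  inverse-cancelˡ i = begin
    lookup x (lookup x' i) ≡⟨ lookup-∘w x x' i ⟨
    lookup (x ∘w x') i     ≡⟨ cong (λ w → lookup w i) (proj₁ inverse) ⟩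
    lookup (ι n) i         ≡⟨ lookup-allFin i ⟩
    i                      ∎
    where open ≡-Reasoning

  inverse-cancelʳ : ∀ i → lookup x' (lookup x i) ≡ i
  inverse-cancelʳ i = begin
    lookup x' (lookup x i) ≡⟨ lookup-∘w x' x i ⟨
    lookup (x' ∘w x) i     ≡⟨ cong (λ w → lookup w i) (proj₂ inverse) ⟩
    lookup (ι n) i         ≡⟨ lookup-allFin i ⟩
    i                      ∎
    where open ≡-Reasoning

record IsSubgroup {ℓ} (G : Word ℓ → Set) : Set where
  field
    ι-closed       : G (ι ℓ)
    ∘w-closed      : ∀ {x y} → G x → G y → G (x ∘w y)
    inverse-closed : ∀ {x x'} → G x → IsInverse x x' → G x'

⟨⟩-least : ∀ {ℓ} {X G : Word ℓ → Set} → IsSubgroup G → (∀ {x} → X x → G x) → ∀ {z} → ⟨ X ⟩ z → G z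
⟨⟩-least G X⊆G (gen x∈X) = X⊆G x∈X
⟨⟩-least G X⊆G one       = IsSubgroup.ι-closed G
⟨⟩-least G X⊆G (mul x y) = IsSubgroup.∘w-closed G (⟨⟩-least G X⊆G x) (⟨⟩-least G X⊆G y)
⟨⟩-least G X⊆G (inv x e) = IsSubgroup.inverse-closed G (⟨⟩-least G X⊆G x) e

ι-pattern⇒equalizing : ∀ {ℓ n} (σ : Word n) → Pat ℓ σ (ι ℓ) → Equalizing ℓ σ
ι-pattern⇒equalizing σ pat = ι _ , pat , one

separatingSubgroup⇒differentiating : ∀ {ℓ n} (σ : Word n) (G : Word ℓ → Set) → IsSubgroup G →
  (∀ {z} → Δ (Pat ℓ σ) z → G z) → (∀ {x} → Pat ℓ σ x → ¬ G x) → Differentiating ℓ σ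
separatingSubgroup⇒differentiating σ G G-subgroup Δ⊆G pattern∉G (x , pat , x∈⟨Δ⟩) =
  pattern∉G pat (⟨⟩-least G-subgroup Δ⊆G x∈⟨Δ⟩)

trivial-isSubgroup : ∀ {ℓ} → IsSubgroup (_≡ ι ℓ)
trivial-isSubgroup = record
  { ι-closed       = refl
  ; ∘w-closed      = λ { refl refl → ∘w-identityˡ _ }
  ; inverse-closed = λ { refl e → trans (sym (∘w-identityˡ _)) (proj₁ e) }
  }

Δ⊆trivial : ∀ {ℓ} {X : Word ℓ → Set} {w} → (∀ {x} → X x → x ≡ w) → ∀ {z} → Δ X z → z ≡ ι ℓ
Δ⊆trivial X≡w (x , y , x' , x∈X , y∈X , e , refl) =
  trans (cong (x' ∘w_) (trans (X≡w y∈X) (sym (X≡w x∈X)))) (proj₂ e)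

Stabilizes : ∀ {ℓ} → (Fin ℓ → Set) → Word ℓ → Set
Stabilizes A z = ∀ i → A i ⇔ A (lookup z i)

stabilizer-isSubgroup : ∀ {ℓ} (A : Fin ℓ → Set) → IsSubgroup (Stabilizes A)
stabilizer-isSubgroup A = record
  { ι-closed       = λ i → subst (λ j → A i ⇔ A j) (sym (lookup-allFin i)) ⇔.refl
  ; ∘w-closed      = λ {x} {y} x-stab y-stab i →
      subst (λ j → A i ⇔ A j) (sym (lookup-∘w x y i)) (⇔.trans (y-stab i) (x-stab _))
  ; inverse-closed = λ {x} {x'} x-stab e i →
      ⇔.sym (subst (λ j → A (lookup x' i) ⇔ A j) (inverse-cancelˡ x x' e i) (x-stab (lookup x' i)))
  }

Δ⊆stabilizer : ∀ {ℓ} {X : Word ℓ → Set} (A B : Fin ℓ → Set) →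
  (∀ {x} → X x → ∀ i → A i ⇔ B (lookup x i)) → ∀ {z} → Δ X z → Stabilizes A z
Δ⊆stabilizer A B carries (x , y , x' , x∈X , y∈X , e , refl) i =
  subst (λ j → A i ⇔ A j) (sym (lookup-∘w x' y i))
    (⇔.trans (carries y∈X i)
      (⇔.sym (subst (λ v → A (lookup x' (lookup y i)) ⇔ B v) (inverse-cancelˡ x x' e _) (carries x∈X _))))

module Commutant {ℓ} (R : Fin ℓ → Fin ℓ → Set)
  (R-total : ∀ a → ∃ (R a))
  (R-functional : ∀ {a b b'} → R a b → R a b' → b ≡ b')
  (R-injective : ∀ {a a' b} → R a b → R a' b → a ≡ a') where

  Commutes : Word ℓ → Set
  Commutes z = ∀ {a b} → R a b → R (lookup z a) (lookup z b)

  Reverses : Word ℓ → Set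
  Reverses x = ∀ {a b} → R a b → R (lookup x b) (lookup x a)

  commutant-isSubgroup : IsSubgroup Commutes
  commutant-isSubgroup = record
    { ι-closed       = λ {a} {b} r → subst₂ R (sym (lookup-allFin a)) (sym (lookup-allFin b)) r
    ; ∘w-closed      = λ {x} {y} x-comm y-comm {a} {b} r →
        subst₂ R (sym (lookup-∘w x y a)) (sym (lookup-∘w x y b)) (x-comm (y-comm r))
    ; inverse-closed = λ {x} {x'} → inverse-commutes {x} {x'}
    }
    where
    inverse-commutes : ∀ {x x'} → Commutes x → IsInverse x x' → Commutes x'
    inverse-commutes {x} {x'} x-comm e {a} {b} r with R-total (lookup x' a)
    ... | c , x'a↦c = subst (R (lookup x' a)) c≡x'b x'a↦c
      where
      c≡x'b : c ≡ lookup x' b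
      c≡x'b = trans (sym (inverse-cancelʳ x x' e c))
        (cong (lookup x') (R-functional
          (subst (λ v → R v (lookup x c)) (inverse-cancelˡ x x' e a) (x-comm x'a↦c)) r))

  -- x⁻¹ ∘ y is a product of two reflections, hence a rotation.
  Δ⊆commutant : ∀ {X} → (∀ {x} → X x → Reverses x) → ∀ {z} → Δ X z → Commutes z
  Δ⊆commutant reverses (x , y , x' , x∈X , y∈X , e , refl) {a} {b} r with R-total (lookup x' (lookup y a))
  ... | c , x'ya↦c = subst₂ R (sym (lookup-∘w x' y a)) (trans c≡x'yb (sym (lookup-∘w x' y b))) x'ya↦c
    where
    c≡x'yb : c ≡ lookup x' (lookup y b)
    c≡x'yb = trans (sym (inverse-cancelʳ x x' e c))
      (cong (lookup x') (R-injective (subst (R (lookup x c)) (inverse-cancelˡ x x' e _) (reverses x∈X x'ya↦c))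
                                      (reverses y∈X r)))

data CyclicSucc {ℓ} : Fin ℓ → Fin ℓ → Set where
  step : ∀ {a b} → toℕ b ≡ suc (toℕ a) → CyclicSucc a b
  wrap : ∀ {a b} → suc (toℕ a) ≡ ℓ → toℕ b ≡ 0 → CyclicSucc a b

cyclicSucc-total : ∀ {ℓ} (a : Fin ℓ) → ∃ (CyclicSucc a)
cyclicSucc-total {ℓ} a with suc (toℕ a) <? ℓ
... | yes a+1<ℓ = fromℕ< a+1<ℓ , step (toℕ-fromℕ< a+1<ℓ)
... | no a+1≮ℓ = fromℕ< (≤-<-trans z≤n (toℕ<n a)) , wrap (≤-antisym (toℕ<n a) (≮⇒≥ a+1≮ℓ)) (toℕ-fromℕ< _)

cyclicSucc-functional : ∀ {ℓ} {a b b' : Fin ℓ} → CyclicSucc a b → CyclicSucc a b' → b ≡ b'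
cyclicSucc-functional (step e) (step e')         = toℕ-injective (trans e (sym e'))
cyclicSucc-functional {b = b} (step e) (wrap s _) = ⊥-elim (<-irrefl (trans e s) (toℕ<n b))
cyclicSucc-functional {b' = b'} (wrap s _) (step e) = ⊥-elim (<-irrefl (trans e s) (toℕ<n b'))
cyclicSucc-functional (wrap _ z) (wrap _ z')      = toℕ-injective (trans z (sym z'))

cyclicSucc-injective : ∀ {ℓ} {a a' b : Fin ℓ} → CyclicSucc a b → CyclicSucc a' b → a ≡ a'
cyclicSucc-injective (step e) (step e')   = toℕ-injective (suc-injective (trans (sym e) e'))
cyclicSucc-injective (step e) (wrap _ z)  = ⊥-elim (0≢1+n (trans (sym z) e))
cyclicSucc-injective (wrap _ z) (step e)  = ⊥-elim (0≢1+n (trans (sym z) e))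
cyclicSucc-injective (wrap s _) (wrap s' _) = toℕ-injective (suc-injective (trans s (sym s')))

cyclicSucc-no2Cycle : ∀ {ℓ} {a b : Fin ℓ} → 3 ≤ ℓ → CyclicSucc a b → ¬ CyclicSucc b a
cyclicSucc-no2Cycle _ (step e) (step e') = <-irrefl (trans e' (cong suc e)) (m<n⇒m<1+n (n<1+n _))
cyclicSucc-no2Cycle ℓ≥3 (step e) (wrap s z) = <-irrefl (trans (sym (cong suc (trans e (cong suc z)))) s) ℓ≥3
cyclicSucc-no2Cycle ℓ≥3 (wrap s z) (step e) = <-irrefl (trans (sym (cong suc (trans e (cong suc z)))) s) ℓ≥3
cyclicSucc-no2Cycle ℓ≥3 (wrap _ z) (wrap s' _) =
  <-irrefl (trans (cong suc (sym z)) s') (<-trans (s≤s (s≤s z≤n)) ℓ≥3)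

-- b − a ≤ d − c, stated additively to avoid truncated subtraction.
interval-injection : ∀ {ℓ} {a b c d} (g : Fin ℓ → ℕ) → (∀ i j → g i ≡ g j → i ≡ j) →
  b ≤ ℓ → a ≤ b → c ≤ d → (∀ i → a ≤ toℕ i → toℕ i < b → c ≤ g i × g i < d) → b + c ≤ d + a
interval-injection {ℓ} {a} {b} {c} {d} g g-injective b≤ℓ a≤b c≤d g-range = begin
  b + c             ≡⟨ cong (_+ c) (m∸n+n≡m a≤b) ⟨
  b ∸ a + a + c     ≤⟨ +-monoˡ-≤ c (+-monoˡ-≤ a (injective⇒≤ f-injective)) ⟩
  d ∸ c + a + c     ≡⟨ +-assoc (d ∸ c) a c ⟩
  d ∸ c + (a + c)   ≡⟨ cong (d ∸ c +_) (+-comm a c) ⟩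
  d ∸ c + (c + a)   ≡⟨ +-assoc (d ∸ c) c a ⟨
  d ∸ c + c + a     ≡⟨ cong (_+ a) (m∸n+n≡m c≤d) ⟩
  d + a             ∎
  where
  open ≤-Reasoning
  a+v<b : (v : Fin (b ∸ a)) → a + toℕ v < b
  a+v<b v = subst (a + toℕ v <_) (m+[n∸m]≡n a≤b) (+-monoʳ-< a (toℕ<n v))
  position : Fin (b ∸ a) → Fin ℓ
  position v = fromℕ< (<-≤-trans (a+v<b v) b≤ℓ)
  in-range : ∀ v → c ≤ g (position v) × g (position v) < d
  in-range v = g-range (position v) (subst (a ≤_) (sym (toℕ-fromℕ< _)) (m≤m+n a _))
                                    (subst (_< b) (sym (toℕ-fromℕ< _)) (a+v<b v))
  f : Fin (b ∸ a) → Fin (d ∸ c)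
  f v = fromℕ< (∸-monoˡ-< (proj₂ (in-range v)) (proj₁ (in-range v)))
  f-injective : ∀ {v w} → f v ≡ f w → v ≡ w
  f-injective {v} {w} fv≡fw = toℕ-injective (+-cancelˡ-≡ a _ _ (begin-equality
    a + toℕ v           ≡⟨ toℕ-fromℕ< _ ⟨
    toℕ (position v)    ≡⟨ cong toℕ (g-injective _ _ gv≡gw) ⟩
    toℕ (position w)    ≡⟨ toℕ-fromℕ< _ ⟩
    a + toℕ w           ∎))
    where
    gv≡gw : g (position v) ≡ g (position w)
    gv≡gw = ∸-cancelʳ-≡ (proj₁ (in-range v)) (proj₁ (in-range w))
      (trans (sym (toℕ-fromℕ< _)) (trans (cong toℕ fv≡fw) (toℕ-fromℕ< _)))

module Increasing {ℓ} (f : Fin ℓ → ℕ) (f↑ : ∀ i j → toℕ i < toℕ j → f i < f j) where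

  injective : ∀ i j → f i ≡ f j → i ≡ j
  injective i j fi≡fj with <-cmp (toℕ i) (toℕ j)
  ... | tri< i<j _ _ = ⊥-elim (<-irrefl fi≡fj (f↑ i j i<j))
  ... | tri≈ _ i≡j _ = toℕ-injective i≡j
  ... | tri> _ _ j<i = ⊥-elim (<-irrefl (sym fi≡fj) (f↑ j i j<i))

  ≤-mono : ∀ i j → toℕ i ≤ toℕ j → f i ≤ f j
  ≤-mono i j i≤j with m≤n⇒m<n∨m≡n i≤j
  ... | inj₁ i<j = <⇒≤ (f↑ i j i<j)
  ... | inj₂ i≡j = ≤-reflexive (cong f (toℕ-injective i≡j))

  <-reflect : ∀ i j → f i < f j → toℕ i < toℕ j
  <-reflect i j fi<fj = ≰⇒> λ j≤i → <⇒≱ fi<fj (≤-mono j i j≤i)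

  index≤ : ∀ i → toℕ i ≤ f i
  index≤ i = subst₂ _≤_ (+-identityʳ (toℕ i)) (+-identityʳ (f i))
    (interval-injection f injective (<⇒≤ (toℕ<n i)) z≤n z≤n (λ j _ j<i → z≤n , f↑ j i j<i))

  bounded : ∀ N → (∀ i → f i < N) → ∀ i → f i + ℓ ≤ toℕ i + N
  bounded N f<N i = s≤s⁻¹ (subst₂ _≤_ (+-suc-comm ℓ (f i)) (+-suc-comm N (toℕ i))
    (interval-injection f injective ≤-refl (toℕ<n i) (f<N i) (λ j i<j _ → f↑ i j i<j , f<N j)))
    where
    +-suc-comm : ∀ m n → m + suc n ≡ suc (n + m)
    +-suc-comm m n = trans (+-suc m n) (cong suc (+-comm m n))

increasing-endo≡id : ∀ {n} (f : Fin n → Fin n) → (∀ i j → i Fin.< j → f i Fin.< f j) → ∀ i → f i ≡ i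
increasing-endo≡id {n} f f↑ i =
  toℕ-injective (≤-antisym (+-cancelʳ-≤ n _ _ (bounded n (λ j → toℕ<n (f j)) i)) (index≤ i))
  where open Increasing (λ j → toℕ (f j)) f↑

-- Patterns

-- For x = σ_S we have h = h_S and t = h_σ(S); x is the relative order of the values val.
module Pattern {ℓ n} (σ : Word n) (x : Word ℓ) (pat : Pat ℓ σ x) where

  h t : Vec (Fin n) ℓ
  h = proj₁ pat
  t = proj₁ (proj₂ pat)

  h↑ : StrictlyIncreasing h
  h↑ = proj₁ (proj₂ (proj₂ pat))

  t↑ : StrictlyIncreasing t
  t↑ = proj₁ (proj₂ (proj₂ (proj₂ pat)))

  t-onto : ∀ k → ∃ λ i → lookup t k ≡ lookup σ (lookup h i)
  t-onto = proj₁ (proj₂ (proj₂ (proj₂ (proj₂ pat))))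

  t∘x≡σ∘h : ∀ i → lookup t (lookup x i) ≡ lookup σ (lookup h i)
  t∘x≡σ∘h = proj₂ (proj₂ (proj₂ (proj₂ (proj₂ pat))))

  pos val rank : Fin ℓ → ℕ
  pos i = toℕ (lookup h i)
  val i = toℕ (lookup σ (lookup h i))
  rank i = toℕ (lookup x i)

  module Pos = Increasing pos h↑
  private module T = Increasing (λ k → toℕ (lookup t k)) t↑

  private
    val≡t∘rank : ∀ i → val i ≡ toℕ (lookup t (lookup x i))
    val≡t∘rank i = sym (cong toℕ (t∘x≡σ∘h i))

  rank≤val : ∀ i → rank i ≤ val i
  rank≤val i = subst (rank i ≤_) (sym (val≡t∘rank i)) (T.index≤ (lookup x i))

  val+ℓ≤rank+n : ∀ i → val i + ℓ ≤ rank i + n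
  val+ℓ≤rank+n i = subst (λ v → v + ℓ ≤ rank i + n) (sym (val≡t∘rank i))
    (T.bounded n (λ k → toℕ<n (lookup t k)) (lookup x i))

  rank<⇒val< : ∀ i j → rank i < rank j → val i < val j
  rank<⇒val< i j ri<rj = subst₂ _<_ (sym (val≡t∘rank i)) (sym (val≡t∘rank j)) (t↑ _ _ ri<rj)

  val<⇒rank< : ∀ i j → val i < val j → rank i < rank j
  val<⇒rank< i j vi<vj = T.<-reflect _ _ (subst₂ _<_ (val≡t∘rank i) (val≡t∘rank j) vi<vj)

  val≤⇒rank≤ : ∀ i j → val i ≤ val j → rank i ≤ rank j
  val≤⇒rank≤ i j vi≤vj = ≮⇒≥ λ rj<ri → <⇒≱ (rank<⇒val< j i rj<ri) vi≤vj

  x-surjective : ∀ v → ∃ λ j → lookup x j ≡ v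
  x-surjective v with t-onto v
  ... | j , tv≡σhj = j , sym (T.injective v (lookup x j) (trans (cong toℕ tv≡σhj) (val≡t∘rank j)))

  rank-surjective : ∀ u → u < ℓ → ∃ λ j → rank j ≡ u
  rank-surjective u u<ℓ with x-surjective (fromℕ< u<ℓ)
  ... | j , xj≡u = j , trans (cong toℕ xj≡u) (toℕ-fromℕ< u<ℓ)

  rank-successor : ∀ i j → val i < val j → (∀ k → val i < val k → val j ≤ val k) → rank j ≡ suc (rank i)
  rank-successor i j vi<vj next
    with rank-surjective (suc (rank i)) (≤-<-trans (val<⇒rank< i j vi<vj) (toℕ<n (lookup x j)))
  ... | k , rk≡ri+1 = ≤-antisym (subst (rank j ≤_) rk≡ri+1 rj≤rk) (val<⇒rank< i j vi<vj)
    where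
    rj≤rk : rank j ≤ rank k
    rj≤rk = val≤⇒rank≤ j k (next k (rank<⇒val< i k (≤-reflexive (sym rk≡ri+1))))

  rank-maximum : ∀ i → (∀ k → ¬ val i < val k) → suc (rank i) ≡ ℓ
  rank-maximum i maximal = ≤-antisym (toℕ<n (lookup x i)) (≮⇒≥ ri+1≮ℓ)
    where
    ri+1≮ℓ : ¬ suc (rank i) < ℓ
    ri+1≮ℓ ri+1<ℓ with rank-surjective (suc (rank i)) ri+1<ℓ
    ... | k , rk≡ri+1 = maximal k (rank<⇒val< i k (≤-reflexive (sym rk≡ri+1)))

  rank-minimum : ∀ i → (∀ k → ¬ val k < val i) → rank i ≡ 0
  rank-minimum i minimal with rank-surjective 0 (≤-<-trans z≤n (toℕ<n (lookup x i)))
  ... | k , rk≡0 = n≤0⇒n≡0 (≮⇒≥ λ 0<ri → minimal k (rank<⇒val< k i (subst (_< rank i) (sym rk≡0) 0<ri)))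

  private
    preimage : Fin ℓ → ℕ
    preimage v = toℕ (proj₁ (x-surjective v))

    preimage-injective : ∀ v w → preimage v ≡ preimage w → v ≡ w
    preimage-injective v w eq = trans (sym (proj₂ (x-surjective v)))
      (trans (cong (lookup x) (toℕ-injective eq)) (proj₂ (x-surjective w)))

    rank-preimage : ∀ v → rank (proj₁ (x-surjective v)) ≡ toℕ v
    rank-preimage v = cong toℕ (proj₂ (x-surjective v))

  count-above : ∀ i → (∀ j → rank i < rank j → toℕ j < toℕ i) → ℓ ≤ toℕ i + suc (rank i)
  count-above i larger-lie-left = subst (_≤ toℕ i + suc (rank i)) (+-identityʳ ℓ)
    (interval-injection preimage preimage-injective ≤-refl (toℕ<n (lookup x i)) z≤n
      (λ v ri<v _ → z≤n , larger-lie-left _ (subst (rank i <_) (sym (rank-preimage v)) ri<v)))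

  count-below : ∀ i → (∀ j → rank j < rank i → toℕ i < toℕ j) → rank i + suc (toℕ i) ≤ ℓ
  count-below i smaller-lie-right = subst (rank i + suc (toℕ i) ≤_) (+-identityʳ ℓ)
    (interval-injection preimage preimage-injective (<⇒≤ (toℕ<n (lookup x i))) z≤n (toℕ<n i)
      (λ v _ v<ri → smaller-lie-right _ (subst (_< rank i) (sym (rank-preimage v)) v<ri) , toℕ<n _))

allFin-increasing : ∀ n → StrictlyIncreasing (allFin n)
allFin-increasing n i j i<j = subst₂ Fin._<_ (sym (lookup-allFin i)) (sym (lookup-allFin j)) i<j

singleton-increasing : ∀ {n} (v : Vec (Fin n) 1) → StrictlyIncreasing v
singleton-increasing v Fin.zero Fin.zero ()

pair-increasing : ∀ {n} {a b : Fin n} → a Fin.< b → StrictlyIncreasing (a ∷ b ∷ [])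
pair-increasing a<b Fin.zero Fin.zero ()
pair-increasing a<b Fin.zero (Fin.suc Fin.zero) _ = a<b
pair-increasing a<b (Fin.suc Fin.zero) (Fin.suc Fin.zero) (s≤s ())

ι-selfPattern : ∀ n → Pat n (ι n) (ι n)
ι-selfPattern n = allFin n , allFin n , allFin-increasing n , allFin-increasing n ,
  (λ k → k , cong (lookup (allFin n)) (sym (lookup-allFin k))) ,
  (λ i → refl)

ι₁-pattern : ∀ {n} (σ : Word (suc n)) → Pat 1 σ (ι 1)
ι₁-pattern σ = Fin.zero ∷ [] , lookup σ Fin.zero ∷ [] ,
  singleton-increasing (Fin.zero ∷ []) , singleton-increasing (lookup σ Fin.zero ∷ []) ,
  (λ { Fin.zero → Fin.zero , refl }) , (λ { Fin.zero → refl })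

ascent⇒ι₂-pattern : ∀ {n} (σ : Word n) {i j} → i Fin.< j → lookup σ i Fin.< lookup σ j → Pat 2 σ (ι 2)
ascent⇒ι₂-pattern σ {i} {j} i<j σi<σj =
  i ∷ j ∷ [] , lookup σ i ∷ lookup σ j ∷ [] , pair-increasing i<j , pair-increasing σi<σj ,
  (λ { Fin.zero → Fin.zero , refl ; (Fin.suc Fin.zero) → Fin.suc Fin.zero , refl }) ,
  (λ { Fin.zero → refl ; (Fin.suc Fin.zero) → refl })

full-pattern≡ : ∀ {n} (σ : Word n) {x} → Pat n σ x → x ≡ σ
full-pattern≡ {n} σ {x} pat = ≡-fromLookup λ i → begin
  lookup x i             ≡⟨ increasing-endo≡id (lookup t) t↑ (lookup x i) ⟨
  lookup t (lookup x i)  ≡⟨ t∘x≡σ∘h i ⟩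
  lookup σ (lookup h i)  ≡⟨ cong (lookup σ) (increasing-endo≡id (lookup h) h↑ i) ⟩
  lookup σ i             ∎
  where
  open Pattern σ x pat
  open ≡-Reasoning

equalizing-at-full-length⇔ι : ∀ {n} (σ : Word n) → Equalizing n σ ⇔ (σ ≡ ι n)
equalizing-at-full-length⇔ι {n} σ = mk⇔ to from
  where
  to : Equalizing n σ → σ ≡ ι n
  to (x , pat , x∈⟨Δ⟩) = trans (sym (full-pattern≡ σ pat))
    (⟨⟩-least trivial-isSubgroup (Δ⊆trivial (full-pattern≡ σ)) x∈⟨Δ⟩)
  from : σ ≡ ι n → Equalizing n σ
  from refl = ι-pattern⇒equalizing (ι n) (ι-selfPattern n)

toℕ-lookup-δ : ∀ n i → toℕ (lookup (δ n) i) ≡ n ∸ suc (toℕ i)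
toℕ-lookup-δ n i = trans (cong toℕ (lookup∘tabulate opposite i)) (opposite-prop i)

opposite-decreasing : ∀ {n} (i j : Fin n) → toℕ i < toℕ j → toℕ (opposite j) < toℕ (opposite i)
opposite-decreasing {n} i j i<j =
  subst₂ _<_ (sym (opposite-prop j)) (sym (opposite-prop i)) (∸-monoʳ-< (s≤s i<j) (toℕ<n j))

δ-decreasing : ∀ n (i j : Fin n) → toℕ i < toℕ j → toℕ (lookup (δ n) j) < toℕ (lookup (δ n) i)
δ-decreasing n i j i<j = subst₂ _<_ (sym (cong toℕ (lookup∘tabulate opposite j)))
  (sym (cong toℕ (lookup∘tabulate opposite i))) (opposite-decreasing i j i<j)

decreasing≡δ : ∀ {n} (σ : Word n) → (∀ i j → toℕ i < toℕ j → toℕ (lookup σ j) < toℕ (lookup σ i)) → σ ≡ δ n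
decreasing≡δ {n} σ σ↓ = ≡-fromLookup λ i → begin
  lookup σ i                        ≡⟨ cong (lookup σ) (opposite-involutive i) ⟨
  lookup σ (opposite (opposite i))  ≡⟨ σ∘opposite≡id (opposite i) ⟩
  opposite i                        ≡⟨ lookup∘tabulate opposite i ⟨
  lookup (δ n) i                    ∎
  where
  open ≡-Reasoning
  σ∘opposite≡id : ∀ i → lookup σ (opposite i) ≡ i
  σ∘opposite≡id = increasing-endo≡id (λ i → lookup σ (opposite i))
    (λ i j i<j → σ↓ (opposite j) (opposite i) (opposite-decreasing i j i<j))

pattern₂-of-δ : ∀ n {x : Word 2} → Pat 2 (δ n) x → x ≡ δ 2
pattern₂-of-δ n {x} pat = ≡-fromLookup λ
  { Fin.zero → toℕ-injective rank0≡1
  ; (Fin.suc Fin.zero) → toℕ-injective rank1≡0 }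
  where
  open Pattern (δ n) x pat
  rank1<rank0 : rank (Fin.suc Fin.zero) < rank Fin.zero
  rank1<rank0 = val<⇒rank< _ _ (δ-decreasing n _ _ (h↑ Fin.zero (Fin.suc Fin.zero) z<s))
  rank0≡1 : rank Fin.zero ≡ 1
  rank0≡1 = ≤-antisym (s≤s⁻¹ (toℕ<n (lookup x Fin.zero))) (≤-trans (s≤s z≤n) rank1<rank0)
  rank1≡0 : rank (Fin.suc Fin.zero) ≡ 0
  rank1≡0 = n≤0⇒n≡0 (s≤s⁻¹ (subst (rank (Fin.suc Fin.zero) <_) rank0≡1 rank1<rank0))

two-differentiating⇔δ : ∀ {n} (σ : Word n) → IsPerm σ → Differentiating 2 σ ⇔ (σ ≡ δ n)
two-differentiating⇔δ {n} σ σ-injective = mk⇔ to from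
  where
  to : Differentiating 2 σ → σ ≡ δ n
  to differentiating = decreasing≡δ σ σ↓
    where
    σ↓ : ∀ i j → toℕ i < toℕ j → toℕ (lookup σ j) < toℕ (lookup σ i)
    σ↓ i j i<j with <-cmp (toℕ (lookup σ i)) (toℕ (lookup σ j))
    ... | tri< σi<σj _ _ = ⊥-elim (differentiating (ι-pattern⇒equalizing σ (ascent⇒ι₂-pattern σ i<j σi<σj)))
    ... | tri≈ _ σi≡σj _ = ⊥-elim (<-irrefl (cong toℕ (σ-injective i j (toℕ-injective σi≡σj))) i<j)
    ... | tri> _ _ σj<σi = σj<σi
  from : σ ≡ δ n → Differentiating 2 σ
  from refl = separatingSubgroup⇒differentiating (δ n) (_≡ ι 2) trivial-isSubgroup
    (Δ⊆trivial (pattern₂-of-δ n))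
    (λ pat x≡ι → δ₂≢ι₂ (trans (sym (pattern₂-of-δ n pat)) x≡ι))
    where
    δ₂≢ι₂ : ¬ δ 2 ≡ ι 2
    δ₂≢ι₂ ()

toℕ-reduce≥ : ∀ {m n} (i : Fin (m + n)) .(m≤i : m ≤ toℕ i) → toℕ (reduce≥ {m} i m≤i) ≡ toℕ i ∸ m
toℕ-reduce≥ {zero} i m≤i = refl
toℕ-reduce≥ {suc m} (Fin.suc i) m≤i = toℕ-reduce≥ {m} i (s≤s⁻¹ m≤i)

module _ {a b} (π : Word a) (τ : Word b) (P : Fin (a + b)) where

  toℕ-lookup-⊕ˡ : (P<a : toℕ P < a) → toℕ (lookup (π ⊕ τ) P) ≡ toℕ (lookup π (fromℕ< P<a))
  toℕ-lookup-⊕ˡ P<a = trans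
    (cong toℕ (trans (lookup-++-< (map (_↑ˡ b) π) (map (a ↑ʳ_) τ) P P<a) (lookup-map _ (_↑ˡ b) π)))
    (toℕ-↑ˡ _ b)

  toℕ-lookup-⊕ʳ : (a≤P : a ≤ toℕ P) → toℕ (lookup (π ⊕ τ) P) ≡ a + toℕ (lookup τ (reduce≥ P a≤P))
  toℕ-lookup-⊕ʳ a≤P = trans
    (cong toℕ (trans (lookup-++-≥ (map (_↑ˡ b) π) (map (a ↑ʳ_) τ) P a≤P) (lookup-map _ (a ↑ʳ_) τ)))
    (toℕ-↑ʳ a _)

  private
    shiftUp : Fin a → Fin (a + b)
    shiftUp i = cast (+-comm b a) (b ↑ʳ i)
    keep : Fin b → Fin (a + b)
    keep j = cast (+-comm b a) (j ↑ˡ a)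

  toℕ-lookup-⊖ˡ : (P<a : toℕ P < a) → toℕ (lookup (π ⊖ τ) P) ≡ b + toℕ (lookup π (fromℕ< P<a))
  toℕ-lookup-⊖ˡ P<a = trans
    (cong toℕ (trans (lookup-++-< (map shiftUp π) (map keep τ) P P<a) (lookup-map _ shiftUp π)))
    (trans (toℕ-cast _ _) (toℕ-↑ʳ b _))

  toℕ-lookup-⊖ʳ : (a≤P : a ≤ toℕ P) → toℕ (lookup (π ⊖ τ) P) ≡ toℕ (lookup τ (reduce≥ P a≤P))
  toℕ-lookup-⊖ʳ a≤P = trans
    (cong toℕ (trans (lookup-++-≥ (map shiftUp π) (map keep τ) P a≤P) (lookup-map _ keep τ)))
    (trans (toℕ-cast _ _) (toℕ-↑ˡ _ a))

-- Skew sums π ⊖ δ_r ⊖ τ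

module SkewSum (p q r : ℕ) (π : Word p) (τ : Word q) where

  σ : Word (p + r + q)
  σ = (π ⊖ δ r) ⊖ τ

  value : Fin (p + r + q) → ℕ
  value P = toℕ (lookup σ P)

  data Block (P : Fin (p + r + q)) : Set where
    top    : toℕ P < p → Block P
    middle : p ≤ toℕ P → toℕ P < p + r → Block P
    bottom : p + r ≤ toℕ P → Block P

  block : ∀ P → Block P
  block P with toℕ P <? p | toℕ P <? p + r
  ... | yes P<p | _        = top P<p
  ... | no P≮p | yes P<p+r = middle (≮⇒≥ P≮p) P<p+r
  ... | no _   | no P≮p+r  = bottom (≮⇒≥ P≮p+r)

  top-value : ∀ P → toℕ P < p → q + r ≤ value P
  top-value P P<p = subst (q + r ≤_) (sym value≡) (+-monoʳ-≤ q (m≤m+n r _))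
    where
    P<p+r : toℕ P < p + r
    P<p+r = <-≤-trans P<p (m≤m+n p r)
    P'<p : toℕ (fromℕ< P<p+r) < p
    P'<p = subst (_< p) (sym (toℕ-fromℕ< P<p+r)) P<p
    value≡ : value P ≡ q + (r + toℕ (lookup π (fromℕ< P'<p)))
    value≡ = trans (toℕ-lookup-⊖ˡ (π ⊖ δ r) τ P P<p+r) (cong (q +_) (toℕ-lookup-⊖ˡ π (δ r) _ P'<p))

  middle-value : ∀ P → p ≤ toℕ P → toℕ P < p + r → value P ≡ q + (r ∸ suc (toℕ P ∸ p))
  middle-value P p≤P P<p+r = begin
    value P                                              ≡⟨ toℕ-lookup-⊖ˡ (π ⊖ δ r) τ P P<p+r ⟩
    q + toℕ (lookup (π ⊖ δ r) P')                         ≡⟨ cong (q +_) (toℕ-lookup-⊖ʳ π (δ r) P' p≤P') ⟩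
    q + toℕ (lookup (δ r) (reduce≥ P' p≤P'))              ≡⟨ cong (q +_) (toℕ-lookup-δ r _) ⟩
    q + (r ∸ suc (toℕ (reduce≥ P' p≤P')))                 ≡⟨ cong (λ k → q + (r ∸ suc k)) (toℕ-reduce≥ P' p≤P') ⟩
    q + (r ∸ suc (toℕ P' ∸ p))                            ≡⟨ cong (λ k → q + (r ∸ suc (k ∸ p))) (toℕ-fromℕ< P<p+r) ⟩
    q + (r ∸ suc (toℕ P ∸ p))                             ∎
    where
    open ≡-Reasoning
    P' : Fin (p + r)
    P' = fromℕ< P<p+r
    p≤P' : p ≤ toℕ P'
    p≤P' = subst (p ≤_) (sym (toℕ-fromℕ< P<p+r)) p≤P

  bottom-value : ∀ P → p + r ≤ toℕ P → value P < q
  bottom-value P p+r≤P = subst (_< q) (sym (toℕ-lookup-⊖ʳ (π ⊖ δ r) τ P p+r≤P)) (toℕ<n _)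

  middle-range : ∀ P → p ≤ toℕ P → toℕ P < p + r → q ≤ value P × value P < q + r
  middle-range P p≤P P<p+r =
    subst (q ≤_) (sym (middle-value P p≤P P<p+r)) (m≤m+n q _) ,
    subst (_< q + r) (sym (middle-value P p≤P P<p+r)) (+-monoʳ-< q (∸-monoʳ-< z<s offset<r))
    where
    offset<r : suc (toℕ P ∸ p) ≤ r
    offset<r = +-cancelˡ-≤ p _ _ (subst (_≤ p + r) (sym (trans (+-suc p _) (cong suc (m+[n∸m]≡n p≤P)))) P<p+r)

  middle-decreasing : ∀ P P' → p ≤ toℕ P → toℕ P ≤ toℕ P' → toℕ P' < p + r → value P' ≤ value P
  middle-decreasing P P' p≤P P≤P' P'<p+r =
    subst₂ _≤_ (sym (middle-value P' (≤-trans p≤P P≤P') P'<p+r))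
               (sym (middle-value P p≤P (≤-<-trans P≤P' P'<p+r)))
      (+-monoʳ-≤ q (∸-monoʳ-≤ r (s≤s (∸-monoˡ-≤ p P≤P'))))

  module _ {x : Word (p + q)} (pat : Pat (p + q) σ x) where
    open Pattern σ x pat

    private
      ≤+r : ∀ {f} k → f + (p + q) ≤ k + (p + r + q) → f ≤ k + r
      ≤+r {f} k le = +-cancelʳ-≤ (p + q) f (k + r) (subst (f + (p + q) ≤_) (begin
        k + (p + r + q)   ≡⟨ cong (λ s → k + (s + q)) (+-comm p r) ⟩
        k + (r + p + q)   ≡⟨ cong (k +_) (+-assoc r p q) ⟩
        k + (r + (p + q)) ≡⟨ +-assoc k r (p + q) ⟨
        k + r + (p + q)   ∎) le)
        where open ≡-Reasoning

    pos≤index+r : ∀ i → pos i ≤ toℕ i + r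
    pos≤index+r i = ≤+r (toℕ i) (Pos.bounded (p + r + q) (λ j → toℕ<n (lookup h j)) i)

    val≤rank+r : ∀ i → val i ≤ rank i + r
    val≤rank+r i = ≤+r (rank i) (val+ℓ≤rank+n i)

    top-rank : ∀ i → toℕ i < p → q ≤ rank i
    top-rank i i<p with block (lookup h i)
    ... | top pos<p = +-cancelʳ-≤ r q (rank i) (≤-trans (top-value _ pos<p) (val≤rank+r i))
    ... | bottom p+r≤pos = ⊥-elim (<⇒≱ (+-monoˡ-< r i<p) (≤-trans p+r≤pos (pos≤index+r i)))
    ... | middle p≤pos pos<p+r = +-cancelˡ-≤ p q (rank i) (≤-trans (count-above i larger-lie-left)
      (subst (_≤ p + rank i) (sym (+-suc (toℕ i) (rank i))) (+-monoˡ-≤ (rank i) i<p)))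
      where
      larger-lie-left : ∀ j → rank i < rank j → toℕ j < toℕ i
      larger-lie-left j ri<rj = Pos.<-reflect j i (≰⇒> pi≰pj)
        where
        vi<vj : val i < val j
        vi<vj = rank<⇒val< i j ri<rj
        pi≰pj : ¬ pos i ≤ pos j
        pi≰pj pi≤pj with block (lookup h j)
        ... | top pj<p = <⇒≱ pj<p (≤-trans p≤pos pi≤pj)
        ... | middle _ pj<p+r = <⇒≱ vi<vj (middle-decreasing _ _ p≤pos pi≤pj pj<p+r)
        ... | bottom p+r≤pj =
          <-asym vi<vj (<-≤-trans (bottom-value _ p+r≤pj) (proj₁ (middle-range _ p≤pos pos<p+r)))

    bottom-rank : ∀ i → p ≤ toℕ i → rank i < q
    bottom-rank i p≤i with block (lookup h i)
    ... | top pos<p = ⊥-elim (<⇒≱ pos<p (≤-trans p≤i (Pos.index≤ i)))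
    ... | bottom p+r≤pos = ≤-<-trans (rank≤val i) (bottom-value _ p+r≤pos)
    ... | middle p≤pos pos<p+r = +-cancelʳ-≤ p (suc (rank i)) q (begin
      suc (rank i) + p       ≡⟨ +-suc (rank i) p ⟨
      rank i + suc p         ≤⟨ +-monoʳ-≤ (rank i) (s≤s p≤i) ⟩
      rank i + suc (toℕ i)   ≤⟨ count-below i smaller-lie-right ⟩
      p + q                  ≡⟨ +-comm p q ⟩
      q + p                  ∎)
      where
      open ≤-Reasoning
      smaller-lie-right : ∀ j → rank j < rank i → toℕ i < toℕ j
      smaller-lie-right j rj<ri = Pos.<-reflect i j (≰⇒> pj≰pi)
        where
        vj<vi : val j < val i
        vj<vi = rank<⇒val< j i rj<ri
        pj≰pi : ¬ pos j ≤ pos i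
        pj≰pi pj≤pi with block (lookup h j)
        ... | top pj<p =
          <-asym vj<vi (<-≤-trans (proj₂ (middle-range _ p≤pos pos<p+r)) (top-value _ pj<p))
        ... | middle p≤pj _ = <⇒≱ vj<vi (middle-decreasing _ _ p≤pj pj≤pi pos<p+r)
        ... | bottom p+r≤pj = <⇒≱ pos<p+r (≤-trans p+r≤pj pj≤pi)

    top-positions⇔top-ranks : ∀ i → toℕ i < p ⇔ q ≤ rank i
    top-positions⇔top-ranks i = mk⇔ (top-rank i) λ q≤ri → ≰⇒> λ p≤i → <⇒≱ (bottom-rank i p≤i) q≤ri

skewSum-differentiating : ∀ p q r → 1 ≤ p → 1 ≤ q → (π : Word p) (τ : Word q) →
  Differentiating (p + q) ((π ⊖ δ r) ⊖ τ)
skewSum-differentiating p q r p≥1 q≥1 π τ =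
  separatingSubgroup⇒differentiating σ (Stabilizes Top) (stabilizer-isSubgroup Top)
    (Δ⊆stabilizer Top (λ v → q ≤ toℕ v) (λ {x} → top-positions⇔top-ranks {x})) (λ {x} → pattern-moves-top {x})
  where
  open SkewSum p q r π τ
  Top : Fin (p + q) → Set
  Top i = toℕ i < p
  pattern-moves-top : ∀ {x} → Pat (p + q) σ x → ¬ Stabilizes Top x
  pattern-moves-top {x} pat x-stabilizes with Pattern.x-surjective σ x pat (fromℕ< (≤-trans p≥1 (m≤m+n p q)))
  ... | j , xj≡0 = <⇒≱ q≥1 (subst (q ≤_) (trans (cong toℕ xj≡0) (toℕ-fromℕ< _)) q≤xj)
    where
    Top-j : Top j
    Top-j = Equivalence.from (x-stabilizes j) (subst Top (sym xj≡0) (subst (_< p) (sym (toℕ-fromℕ< _)) p≥1))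
    q≤xj : q ≤ toℕ (lookup x j)
    q≤xj = Equivalence.to (top-positions⇔top-ranks {x} pat j) Top-j

-- Direct sums δ_m ⊕ δ_k

module DecreasingSum (m k : ℕ) where

  σ : Word (m + k)
  σ = δ m ⊕ δ k

  value : Fin (m + k) → ℕ
  value P = toℕ (lookup σ P)

  data Block (P : Fin (m + k)) : Set where
    lower : toℕ P < m → Block P
    upper : m ≤ toℕ P → Block P

  block : ∀ P → Block P
  block P with toℕ P <? m
  ... | yes P<m = lower P<m
  ... | no P≮m = upper (≮⇒≥ P≮m)

  lower<upper : ∀ P P' → toℕ P < m → m ≤ toℕ P' → value P < value P'
  lower<upper P P' P<m m≤P' = <-≤-trans
    (subst (_< m) (sym (toℕ-lookup-⊕ˡ (δ m) (δ k) P P<m)) (toℕ<n _))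
    (subst (m ≤_) (sym (toℕ-lookup-⊕ʳ (δ m) (δ k) P' m≤P')) (m≤m+n m _))

  lower-decreasing : ∀ P P' → toℕ P < toℕ P' → toℕ P' < m → value P' < value P
  lower-decreasing P P' P<P' P'<m =
    subst₂ _<_ (sym (toℕ-lookup-⊕ˡ (δ m) (δ k) P' P'<m)) (sym (toℕ-lookup-⊕ˡ (δ m) (δ k) P P<m))
      (δ-decreasing m _ _ (subst₂ _<_ (sym (toℕ-fromℕ< P<m)) (sym (toℕ-fromℕ< P'<m)) P<P'))
    where
    P<m : toℕ P < m
    P<m = <-trans P<P' P'<m

  upper-decreasing : ∀ P P' → m ≤ toℕ P → toℕ P < toℕ P' → value P' < value P
  upper-decreasing P P' m≤P P<P' =
    subst₂ _<_ (sym (toℕ-lookup-⊕ʳ (δ m) (δ k) P' m≤P')) (sym (toℕ-lookup-⊕ʳ (δ m) (δ k) P m≤P))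
      (+-monoʳ-< m (δ-decreasing k _ _
        (subst₂ _<_ (sym (toℕ-reduce≥ P m≤P)) (sym (toℕ-reduce≥ P' m≤P')) (∸-monoˡ-< P<P' m≤P))))
    where
    m≤P' : m ≤ toℕ P'
    m≤P' = ≤-trans m≤P (<⇒≤ P<P')

  module _ {ℓ} {x : Word ℓ} (pat : Pat ℓ σ x) where
    open Pattern σ x pat

    data SameBlock (i j : Fin ℓ) : Set where
      both-lower : pos i < m → pos j < m → SameBlock i j
      both-upper : m ≤ pos i → m ≤ pos j → SameBlock i j

    sameBlock? : ∀ i j → Dec (SameBlock i j)
    sameBlock? i j with block (lookup h i) | block (lookup h j)
    ... | lower pi<m | lower pj<m = yes (both-lower pi<m pj<m)
    ... | upper m≤pi | upper m≤pj = yes (both-upper m≤pi m≤pj)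
    ... | lower pi<m | upper m≤pj = no λ
      { (both-lower _ pj<m) → <⇒≱ pj<m m≤pj ; (both-upper m≤pi _) → <⇒≱ pi<m m≤pi }
    ... | upper m≤pi | lower pj<m = no λ
      { (both-lower pi<m _) → <⇒≱ pi<m m≤pi ; (both-upper _ m≤pj) → <⇒≱ pj<m m≤pj }

    same-block-sym : ∀ {i j} → SameBlock i j → SameBlock j i
    same-block-sym (both-lower pi<m pj<m) = both-lower pj<m pi<m
    same-block-sym (both-upper m≤pi m≤pj) = both-upper m≤pj m≤pi

    same-block-decreasing : ∀ i j → SameBlock i j → toℕ i < toℕ j → val j < val i
    same-block-decreasing i j (both-lower _ pj<m) i<j = lower-decreasing _ _ (h↑ i j i<j) pj<m
    same-block-decreasing i j (both-upper m≤pi _) i<j = upper-decreasing _ _ m≤pi (h↑ i j i<j)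

    same-block-antitone : ∀ i j → SameBlock i j → toℕ i ≤ toℕ j → val j ≤ val i
    same-block-antitone i j same i≤j with m≤n⇒m<n∨m≡n i≤j
    ... | inj₁ i<j = <⇒≤ (same-block-decreasing i j same i<j)
    ... | inj₂ i≡j = ≤-reflexive (cong val (toℕ-injective (sym i≡j)))

    same-block-order : ∀ i j → SameBlock i j → val i < val j → toℕ j < toℕ i
    same-block-order i j same vi<vj = ≰⇒> λ i≤j → <⇒≱ vi<vj (same-block-antitone i j same i≤j)

    block-maximum : ∀ i → (∀ j → SameBlock i j → toℕ i ≤ toℕ j) → (∀ j → ¬ SameBlock i j → val j < val i) →
      suc (rank i) ≡ ℓ
    block-maximum i first other = rank-maximum i not-above
      where
      not-above : ∀ j → ¬ val i < val j
      not-above j vi<vj with sameBlock? i j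
      ... | yes same = <⇒≱ (same-block-order i j same vi<vj) (first j same)
      ... | no apart = <-asym vi<vj (other j apart)

    block-minimum : ∀ i → (∀ j → SameBlock i j → toℕ j ≤ toℕ i) → (∀ j → ¬ SameBlock i j → val i < val j) →
      rank i ≡ 0
    block-minimum i last other = rank-minimum i not-below
      where
      not-below : ∀ j → ¬ val j < val i
      not-below j vj<vi with sameBlock? j i
      ... | yes same = <⇒≱ (same-block-order j i same vj<vi) (last j (same-block-sym same))
      ... | no apart = <-asym vj<vi (other j (λ same → apart (same-block-sym same)))

    apart-from-lower : ∀ {i j} → pos i < m → ¬ SameBlock i j → m ≤ pos j
    apart-from-lower pi<m apart = ≮⇒≥ λ pj<m → apart (both-lower pi<m pj<m)

    apart-from-upper : ∀ {i j} → m ≤ pos i → ¬ SameBlock i j → pos j < m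
    apart-from-upper m≤pi apart = ≰⇒> λ m≤pj → apart (both-upper m≤pi m≤pj)

    same-block-lower : ∀ {i j} → pos i < m → SameBlock i j → pos j < m
    same-block-lower _ (both-lower _ pj<m) = pj<m
    same-block-lower pi<m (both-upper m≤pi _) = ⊥-elim (<⇒≱ pi<m m≤pi)

    same-block-upper : ∀ {i j} → m ≤ pos i → SameBlock i j → m ≤ pos j
    same-block-upper m≤pi (both-lower pi<m _) = ⊥-elim (<⇒≱ pi<m m≤pi)
    same-block-upper _ (both-upper _ m≤pj) = m≤pj

    adjacent-in-block : ∀ a b → toℕ b ≡ suc (toℕ a) → SameBlock a b → rank a ≡ suc (rank b)
    adjacent-in-block a b b≡a+1 same =
      rank-successor b a (same-block-decreasing a b same (≤-reflexive (sym b≡a+1))) next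
      where
      next : ∀ j → val b < val j → val a ≤ val j
      next j vb<vj = by-blocks same (block (lookup h j))
        where
        in-block : SameBlock b j → SameBlock j a → val a ≤ val j
        in-block bj ja = same-block-antitone j a ja
          (s≤s⁻¹ (subst (toℕ j <_) b≡a+1 (same-block-order b j bj vb<vj)))
        by-blocks : SameBlock a b → Block (lookup h j) → val a ≤ val j
        by-blocks (both-lower pa<m pb<m) (lower pj<m) = in-block (both-lower pb<m pj<m) (both-lower pj<m pa<m)
        by-blocks (both-upper m≤pa m≤pb) (upper m≤pj) = in-block (both-upper m≤pb m≤pj) (both-upper m≤pj m≤pa)
        by-blocks (both-lower pa<m _) (upper m≤pj) = <⇒≤ (lower<upper _ _ pa<m m≤pj)
        by-blocks (both-upper _ m≤pb) (lower pj<m) = ⊥-elim (<-asym vb<vj (lower<upper _ _ pj<m m≤pb))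

    reverses : ∀ {a b} → CyclicSucc a b → CyclicSucc (lookup x b) (lookup x a)
    reverses {a} {b} (step b≡a+1) with block (lookup h a) | block (lookup h b)
    ... | lower pa<m | lower pb<m = step (adjacent-in-block a b b≡a+1 (both-lower pa<m pb<m))
    ... | upper m≤pa | upper m≤pb = step (adjacent-in-block a b b≡a+1 (both-upper m≤pa m≤pb))
    ... | upper m≤pa | lower pb<m = ⊥-elim (<⇒≱ pb<m (≤-trans m≤pa (<⇒≤ (h↑ a b (≤-reflexive (sym b≡a+1))))))
    ... | lower pa<m | upper m≤pb = wrap
      (block-maximum b first-upper λ j apart → lower<upper _ _ (apart-from-upper m≤pb apart) m≤pb)
      (block-minimum a last-lower λ j apart → lower<upper _ _ pa<m (apart-from-lower pa<m apart))
      where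
      first-upper : ∀ j → SameBlock b j → toℕ b ≤ toℕ j
      first-upper j same = ≮⇒≥ λ j<b → <⇒≱
        (≤-<-trans (Pos.≤-mono j a (s≤s⁻¹ (subst (toℕ j <_) b≡a+1 j<b))) pa<m) (same-block-upper m≤pb same)
      last-lower : ∀ j → SameBlock a j → toℕ j ≤ toℕ a
      last-lower j same = ≮⇒≥ λ a<j → <⇒≱ (same-block-lower pa<m same)
        (≤-trans m≤pb (Pos.≤-mono b j (subst (_≤ toℕ j) (sym b≡a+1) a<j)))
    reverses {a} {b} (wrap a+1≡ℓ b≡0) = by-blocks (block (lookup h a)) (block (lookup h b))
      where
      b≤ : ∀ j → toℕ b ≤ toℕ j
      b≤ j = subst (_≤ toℕ j) (sym b≡0) z≤n
      ≤a : ∀ j → toℕ j ≤ toℕ a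
      ≤a j = s≤s⁻¹ (subst (toℕ j <_) (sym a+1≡ℓ) (toℕ<n j))
      extremes : (∀ j → SameBlock b j) → (∀ j → SameBlock a j) → CyclicSucc (lookup x b) (lookup x a)
      extremes b-everywhere a-everywhere = wrap
        (block-maximum b (λ j _ → b≤ j) λ j apart → ⊥-elim (apart (b-everywhere j)))
        (block-minimum a (λ j _ → ≤a j) λ j apart → ⊥-elim (apart (a-everywhere j)))
      by-blocks : Block (lookup h a) → Block (lookup h b) → CyclicSucc (lookup x b) (lookup x a)
      by-blocks (lower pa<m) (lower pb<m) =
        extremes (λ j → both-lower pb<m (all-lower j)) (λ j → both-lower pa<m (all-lower j))
        where
        all-lower : ∀ j → pos j < m
        all-lower j = ≤-<-trans (Pos.≤-mono j a (≤a j)) pa<m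
      by-blocks (upper m≤pa) (upper m≤pb) =
        extremes (λ j → both-upper m≤pb (all-upper j)) (λ j → both-upper m≤pa (all-upper j))
        where
        all-upper : ∀ j → m ≤ pos j
        all-upper j = ≤-trans m≤pb (Pos.≤-mono b j (b≤ j))
      by-blocks (lower pa<m) (upper m≤pb) = ⊥-elim (<⇒≱ pa<m (≤-trans m≤pb (Pos.≤-mono b a (b≤ a))))
      by-blocks (upper m≤pa) (lower pb<m) = step (rank-successor b a (lower<upper _ _ pb<m m≤pa) next)
        where
        next : ∀ j → val b < val j → val a ≤ val j
        next j vb<vj with block (lookup h j)
        ... | lower pj<m = ⊥-elim (<⇒≱ (same-block-order b j (both-lower pb<m pj<m) vb<vj) (b≤ j))
        ... | upper m≤pj = same-block-antitone j a (both-upper m≤pj m≤pa) (≤a j)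

decreasingSum-differentiating : ∀ ℓ m k → 3 ≤ ℓ → Differentiating ℓ (δ m ⊕ δ k)
decreasingSum-differentiating ℓ m k ℓ≥3 =
  separatingSubgroup⇒differentiating σ Commutes commutant-isSubgroup
    (Δ⊆commutant (λ {x} pat → reverses {x = x} pat))
    (λ {x} pat commutes → cyclicSucc-no2Cycle ℓ≥3 (reverses {x = x} pat 0↦1) (commutes 0↦1))
  where
  open DecreasingSum m k
  open Commutant (CyclicSucc {ℓ}) cyclicSucc-total cyclicSucc-functional cyclicSucc-injective
  0↦1 : CyclicSucc {ℓ} (fromℕ< (<-trans z<s ℓ≥3)) (fromℕ< (≤-trans (s≤s (s≤s z≤n)) ℓ≥3))
  0↦1 = step (trans (toℕ-fromℕ< _) (cong suc (sym (toℕ-fromℕ< _))))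

proposition6p6 :
    (∀ (n : ℕ) → 1 ≤ n → (σ : Word n) → IsPerm σ → Equalizing 1 σ)
    × (∀ (n : ℕ) → 2 ≤ n → (σ : Word n) → IsPerm σ →
         (Differentiating 2 σ ⇔ (σ ≡ δ n)))
    × (∀ (ℓ m k : ℕ) → 1 ≤ k → 3 ≤ ℓ → ℓ + 1 ≤ m + k →
         Differentiating ℓ (δ m ⊕ δ k))
    × (∀ (p q r : ℕ) → 1 ≤ p → 1 ≤ q → 3 ≤ p + q → 1 ≤ r →
         (π : Word p) → IsPerm π → (τ : Word q) → IsPerm τ →
         Differentiating (p + q) ((π ⊖ δ r) ⊖ τ))
    × (∀ (n : ℕ) → 1 ≤ n → (σ : Word n) → IsPerm σ →
         (Equalizing n σ ⇔ (σ ≡ ι n)))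
proposition6p6 =
  (λ { (suc n) _ σ _ → ι-pattern⇒equalizing σ (ι₁-pattern σ) }) ,
  (λ n _ σ σ-injective → two-differentiating⇔δ σ σ-injective) ,
  (λ ℓ m k _ ℓ≥3 _ → decreasingSum-differentiating ℓ m k ℓ≥3) ,
  (λ p q r p≥1 q≥1 _ _ π _ τ _ → skewSum-differentiating p q r p≥1 q≥1 π τ) ,
  (λ n _ σ _ → equalizing-at-full-length⇔ι σ)
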